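{- Let $(\mathscr{L},\vdash)$ be a logical structure which is of Tarski-type and of Lindenbaum-IV-type, and let $\mathbb{SCS}$ be the set of all characteristic functions $\chi_\Sigma$ of sets $\Sigma\subseteq\mathscr{L}$ that are strongly closed and $\beta$-saturated for some $\beta\in\mathscr{L}$. Then for every $\mathcal{B}\subseteq\mathbb{SCS}$ we have $\vdash\,\subseteq\,\vdash_{\mathcal{B}}$. Moreover, if $\mathcal{B}\subsetneq\mathbb{SCS}$ then $\vdash\,\subsetneq\,\vdash_{\mathcal{B}}$.
   Context: A logical structure is a pair $(\mathscr{L},\vdash)$ with $\mathscr{L}$ a nonempty set and $\vdash\subseteq\mathcal{P}(\mathscr{L})\times\mathscr{L}$ nonempty. Tarski-type: reflexive ($\alpha\in\Gamma\Rightarrow\Gamma\vdash\alpha$), monotone ($\Gamma\vdash\alpha$, $\Gamma\subseteq\Sigma\Rightarrow\Sigma\vdash\alpha$), transitive (if $\Gamma\vdash\beta$ for all $\beta\in\Sigma$ and $\Sigma\vdash\alpha$ then $\Gamma\vdash\alpha$). $\Gamma$ is relatively maximal in $\alpha$ if $\Gamma\nvdash\alpha$ but $\Sigma\vdash\alpha$ for all $\Sigma\supsetneq\Gamma$; Lindenbaum-IV-type: whenever $\Gamma\nvdash\alpha$ there is $\Sigma\supseteq\Gamma$ relatively maximal in $\alpha$. $\Gamma$ is strongly closed if $\Gamma\vdash\alpha$ for all $\alpha\in\Gamma$ and, for all $\alpha$, if some $\Gamma'\subseteq\Gamma$ has $\Gamma'\vdash\alpha$ then $\alpha\in\Gamma$.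 $\Gamma$ is $\beta$-saturated if $\Gamma\nvdash\beta$ but $\Gamma\cup\{\gamma\}\vdash\beta$ for all $\gamma\in\mathscr{L}\setminus\Gamma$. For a set $\mathcal{V}$ of functions $v:\mathscr{L}\to\{0,1\}$, $\Gamma\vdash_{\mathcal{V}}\alpha$ iff every $v\in\mathcal{V}$ with $v(\gamma)=1$ for all $\gamma\in\Gamma$ has $v(\alpha)=1$. -}

module Defs where

open import Data.Bool using (Bool; true; false)
open import Data.Product using (Σ; ∃; ∃-syntax; _×_; _,_)
open import Relation.Nullary using (¬_)
open import Relation.Binary.PropositionalEquality using (_≡_)
open import Function.Bundles using (_⇔_)

Subset : Set → Set₁
Subset L = L → Set

_⊆_ : {L : Set} → Subset L → Subset L → Set
_⊆_ {L} Γ Δ = ∀ (x : L) → Γ x → Δ x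

_⊊_ : {L : Set} → Subset L → Subset L → Set
Γ ⊊ Δ = (Γ ⊆ Δ) × (∃[ x ] (Δ x × ¬ Γ x))

_∪｛_｝ : {L : Set} → Subset L → L → Subset L
(Γ ∪｛ γ ｝) x = Γ x ⊎' (x ≡ γ)
  where
  open import Data.Sum using () renaming (_⊎_ to _⊎'_)

Rel⊢ : Set → Set₁
Rel⊢ L = Subset L → L → Set

module _ {L : Set} (_⊢_ : Rel⊢ L) where

  Reflexive : Set₁
  Reflexive = ∀ (Γ : Subset L) (α : L) → Γ α → Γ ⊢ α

  Monotone : Set₁
  Monotone = ∀ (Γ Δ : Subset L) (α : L) → Γ ⊢ α → Γ ⊆ Δ → Δ ⊢ α

  Transitive : Set₁
  Transitive = ∀ (Γ Δ : Subset L) (α : L) →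
    (∀ (β : L) → Δ β → Γ ⊢ β) → Δ ⊢ α → Γ ⊢ α

  TarskiType : Set₁
  TarskiType = Reflexive × Monotone × Transitive

  RelativelyMaximal : Subset L → L → Set₁
  RelativelyMaximal Γ α = (¬ (Γ ⊢ α)) × (∀ (Δ : Subset L) → Γ ⊊ Δ → Δ ⊢ α)

  LindenbaumIV : Set₁
  LindenbaumIV = ∀ (Γ : Subset L) (α : L) → ¬ (Γ ⊢ α) →
    Σ (Subset L) (λ Δ → (Γ ⊆ Δ) × RelativelyMaximal Δ α)

  StronglyClosed : Subset L → Set₁
  StronglyClosed Γ = (∀ (α : L) → Γ α → Γ ⊢ α)
                   × (∀ (α : L) → (Σ (Subset L) (λ Γ' → (Γ' ⊆ Γ) × (Γ' ⊢ α))) → Γ α)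

  Saturated : L → Subset L → Set
  Saturated β Γ = (¬ (Γ ⊢ β)) × (∀ (γ : L) → ¬ Γ γ → (Γ ∪｛ γ ｝) ⊢ β)

  IsChar : (L → Bool) → Subset L → Set
  IsChar v Γ = ∀ (x : L) → (v x ≡ true) ⇔ Γ x

  SCS : (L → Bool) → Set₁
  SCS v = Σ (Subset L) (λ Γ → IsChar v Γ × StronglyClosed Γ × ∃[ β ] Saturated β Γ)

ValSet : Set → Set₂
ValSet L = (L → Bool) → Set₁

Sem : {L : Set} → ValSet L → Subset L → L → Set₁
Sem {L} 𝒱 Γ α = ∀ (v : L → Bool) → 𝒱 v → (∀ (γ : L) → Γ γ → v γ ≡ true) → v α ≡ true

_⊆ᵣ_ : {L : Set} → Rel⊢ L → (Subset L → L → Set₁) → Set₁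
_⊆ᵣ_ {L} R S = ∀ (Γ : Subset L) (α : L) → R Γ α → S Γ α

_⊊ᵣ_ : {L : Set} → Rel⊢ L → (Subset L → L → Set₁) → Set₁
_⊊ᵣ_ {L} R S = (R ⊆ᵣ S) × Σ (Subset L) (λ Γ → ∃[ α ] (S Γ α × ¬ R Γ α))

-- inclusion of sets of valuations; functions are compared extensionally
-- (pointwise), as they are in set theory
_⊆ᵥ_ : {L : Set} → ValSet L → ValSet L → Set₁
_⊆ᵥ_ {L} 𝒜 ℬ = ∀ (v : L → Bool) → 𝒜 v → ℬ v

_⊊ᵥ_ : {L : Set} → ValSet L → ValSet L → Set₁
_⊊ᵥ_ {L} 𝒜 ℬ = (𝒜 ⊆ᵥ ℬ) ×
  Σ (L → Bool) (λ v → ℬ v × (∀ (w : L → Bool) → 𝒜 w → ¬ (∀ (x : L) → w x ≡ v x)))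

module Submission where

open import Defs
open import Data.Bool using (Bool; true; false; _≟_)
open import Data.Product using (Σ; ∃; ∃-syntax; _×_; _,_)
open import Data.Sum using (inj₁; inj₂)
open import Function.Bundles using (Equivalence; _⇔_)
open import Relation.Nullary using (¬_; Stable)
open import Relation.Nullary.Decidable using (decidable-stable)
open import Relation.Binary.PropositionalEquality using (_≡_; refl)

-- Soundness: a strongly closed set contains every consequence of its subsets, so
-- its characteristic function validates ⊢.  Strictness: for v = χ_Σ in 𝕊ℂ𝕊 ∖ ℬ,
-- with Σ strongly closed and β-saturated, Σ ⊬ β; yet Σ ⊢_ℬ β, because a strongly
-- closed Δ ⊇ Σ omitting β must equal Σ (adding any γ ∉ Σ would derive β inside Δ),
-- so its characteristic function would be v itself, which is not in ℬ.

open Equivalence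

≡true-injective : {a b : Bool} → (a ≡ true ⇔ b ≡ true) → a ≡ b
≡true-injective {false} {false} _ = refl
≡true-injective {false} {true}  a⇔b with () ← from a⇔b refl
≡true-injective {true}  {false} a⇔b with () ← to a⇔b refl
≡true-injective {true}  {true}  _ = refl

module _ {L : Set} {_⊢_ : Rel⊢ L} where

  IsChar-stable : ∀ {v Γ} → IsChar _⊢_ v Γ → ∀ x → Stable (Γ x)
  IsChar-stable {v} χ x ¬¬Γx =
    to (χ x) (decidable-stable (v x ≟ true) (λ vx≢true → ¬¬Γx (λ Γx → vx≢true (from (χ x) Γx))))

  IsChar-unique : ∀ {v w Γ Δ} → IsChar _⊢_ v Γ → IsChar _⊢_ w Δ →
                  Γ ⊆ Δ → Δ ⊆ Γ → ∀ x → w x ≡ v x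
  IsChar-unique χv χw Γ⊆Δ Δ⊆Γ x = ≡true-injective (record
    { to        = λ wx → from (χv x) (Δ⊆Γ x (to (χw x) wx))
    ; from      = λ vx → from (χw x) (Γ⊆Δ x (to (χv x) vx))
    ; to-cong   = λ { refl → refl }
    ; from-cong = λ { refl → refl }
    })

  StronglyClosed-sound : ∀ {v Δ} → IsChar _⊢_ v Δ → StronglyClosed _⊢_ Δ →
                         ∀ {Γ α} → Γ ⊢ α → (∀ γ → Γ γ → v γ ≡ true) → v α ≡ true
  StronglyClosed-sound χ (_ , closed) {Γ} {α} Γ⊢α Γ-true =
    from (χ α) (closed α (Γ , (λ γ Γγ → to (χ γ) (Γ-true γ Γγ)) , Γ⊢α))

  SCS-sound : ∀ {ℬ} → ℬ ⊆ᵥ SCS _⊢_ → _⊢_ ⊆ᵣ Sem ℬ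
  SCS-sound ℬ⊆SCS Γ α Γ⊢α v ℬv with ℬ⊆SCS v ℬv
  ... | _ , χ , closed , _ = StronglyClosed-sound χ closed Γ⊢α

  Saturated-maximal : ∀ {v β Σ' Δ} → IsChar _⊢_ v Σ' → Saturated _⊢_ β Σ' →
                      StronglyClosed _⊢_ Δ → Σ' ⊆ Δ → ¬ Δ β → Δ ⊆ Σ'
  Saturated-maximal {Σ' = Σ'} {Δ} χ (_ , saturated) (_ , closed) Σ'⊆Δ ¬Δβ x Δx =
    IsChar-stable χ x (λ x∉Σ' → ¬Δβ (closed _ (Σ' ∪｛ x ｝ , Σ'x⊆Δ , saturated x x∉Σ')))
    where
    Σ'x⊆Δ : (Σ' ∪｛ x ｝) ⊆ Δ
    Σ'x⊆Δ y (inj₁ Σ'y) = Σ'⊆Δ y Σ'y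
    Σ'x⊆Δ y (inj₂ refl) = Δx

  Saturated-valid : ∀ {ℬ v β Σ'} → ℬ ⊆ᵥ SCS _⊢_ →
                    (∀ w → ℬ w → ¬ (∀ x → w x ≡ v x)) →
                    IsChar _⊢_ v Σ' → Saturated _⊢_ β Σ' → Sem ℬ Σ' β
  Saturated-valid {β = β} ℬ⊆SCS v∉ℬ χv sat w ℬw Σ'-true with ℬ⊆SCS w ℬw
  ... | Δ , χw , closed , _ =
    let Σ'⊆Δ : _ ⊆ Δ
        Σ'⊆Δ x Σ'x = to (χw x) (Σ'-true x Σ'x)
    in from (χw β) (IsChar-stable χw β λ ¬Δβ →
          v∉ℬ w ℬw (IsChar-unique χv χw Σ'⊆Δ (Saturated-maximal χv sat closed Σ'⊆Δ ¬Δβ)))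

mainTheorem5 : (L : Set) (_⊢_ : Rel⊢ L) →
    L → Σ (Subset L) (λ Γ → ∃[ α ] (Γ ⊢ α)) →
    TarskiType _⊢_ → LindenbaumIV _⊢_ →
    (ℬ : ValSet L) → ℬ ⊆ᵥ SCS _⊢_ →
    (_⊢_ ⊆ᵣ Sem ℬ) × (ℬ ⊊ᵥ SCS _⊢_ → _⊢_ ⊊ᵣ Sem ℬ)
mainTheorem5 L _⊢_ _ _ _ _ ℬ ℬ⊆SCS = SCS-sound ℬ⊆SCS , strict
  where
  strict : ℬ ⊊ᵥ SCS _⊢_ → _⊢_ ⊊ᵣ Sem ℬ
  strict (_ , v , (Σ' , χ , _ , β , sat@(Σ'⊬β , _)) , v∉ℬ) =
    SCS-sound ℬ⊆SCS , Σ' , β , Saturated-valid ℬ⊆SCS v∉ℬ χ sat , Σ'⊬β
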